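{- Let $r\in\mathbb N$, $G_1=C_{n_1}^r$, $G_2=C_{n_2}^r$ and $G=C_{n_1n_2}^r$. Suppose that (i) $\frac{\eta(G_1)-1}{n_1-1}=\frac{\eta(G_2)-1}{n_2-1}=\frac{\eta(G)-1}{n_1n_2-1}=c$ for some $c\in\mathbb N$; (ii) $G_2$ has Property C; (iii) there exist $t_1\in[1,n_2-1]$ and $t_2\in\{1,2\}$ with $t_2\leq t_1$ such that $[\eta(G_2)-t_1,\ \eta(G_2)-t_2]\subset C_0(G_2)$. Then $[\eta(G)-t_1,\ \eta(G)-t_2]\subset C_0(G)$.
   Context: $C_n^r$ is the direct sum of $r$ copies of the cyclic group $C_n$; $[a,b]=\{x\in\mathbb Z:a\le x\le b\}$. A sequence over a group $K$ is a finite unordered list of elements with repetition allowed; length counts multiplicity; $g^k$ denotes $k$ copies of $g$. A short zero-sum sequence over $K$ is a sequence with sum $0$ and length in $[1,\exp(K)]$; short free means containing no short zero-sum subsequence. $D(K)$ is the smallest $d$ such that every sequence over $K$ of length $\ge d$ has a nonempty zero-sum subsequence; $\eta(K)$ is the smallest $d$ such that every sequence of length $\ge d$ has a short zero-sum subsequence. $C_0(K)$ is the set of integers $t\in[D(K)+1,\eta(K)-1]$ such that every zero-sum sequence over $K$ of length exactly $t$ contains a short zero-sum subsequence. Property C: $C_n^r$ has Property C if $\eta(C_n^r)=c(n-1)+1$ for some positive integer $c$ and every short free sequence over $C_n^r$ of length $c(n-1)$ has the form $\prod_{i=1}^c g_i^{n-1}$ with $g_1,\dots,g_c$ pairwise distinct.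 -}

module Defs where

open import Data.Nat using (ℕ; zero; suc; _+_; _*_; _∸_; _≤_)
open import Data.Nat.Divisibility using (_∣_)
open import Data.Fin using (Fin; toℕ)
open import Data.Vec using (Vec; lookup)
open import Data.List using (List; length; map; concatMap; replicate)
open import Data.Nat.ListAction using (sum)
open import Relation.Binary.PropositionalEquality using (_≡_)
open import Data.Empty using (⊥)
open import Data.List.Relation.Binary.Sublist.Propositional using (_⊆_)
open import Data.List.Relation.Binary.Permutation.Propositional using (_↭_)
open import Data.List.Relation.Unary.Unique.Propositional using (Unique)
open import Data.Product using (Σ; ∃; _×_)

Elem : ℕ → ℕ → Set
Elem n r = Vec (Fin n) r

-- Sequences over C_n^r (unordered lists; order is irrelevant to all notions below).
Seq : ℕ → ℕ → Set
Seq n r = List (Elem n r)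

-- exponent of C_n^r (trivial group when r = 0)
Exp : ℕ → ℕ → ℕ
Exp n zero    = 1
Exp n (suc r) = n

ZeroSum : ∀ {n r} → Seq n r → Set
ZeroSum {n} {r} S = (i : Fin r) → n ∣ sum (map (λ g → toℕ (lookup g i)) S)

-- subsequence (sub-multiset) = sublist of the list
HasNonemptyZS : ∀ {n r} → Seq n r → Set
HasNonemptyZS {n} {r} S = Σ (Seq n r) λ T → T ⊆ S × ZeroSum T × 1 ≤ length T

HasShortZS : ∀ {n r} → Seq n r → Set
HasShortZS {n} {r} S =
  Σ (Seq n r) λ T → T ⊆ S × ZeroSum T × 1 ≤ length T × length T ≤ Exp n r

Threshold : ∀ n r → (Seq n r → Set) → ℕ → Set
Threshold n r P d = (S : Seq n r) → d ≤ length S → P S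

IsD : ℕ → ℕ → ℕ → Set
IsD n r d = Threshold n r HasNonemptyZS d
          × ((d' : ℕ) → Threshold n r HasNonemptyZS d' → d ≤ d')

IsEta : ℕ → ℕ → ℕ → Set
IsEta n r e = Threshold n r HasShortZS e
            × ((e' : ℕ) → Threshold n r HasShortZS e' → e ≤ e')

-- t ∈ C_0(C_n^r), given D(C_n^r) = d and η(C_n^r) = e
InC0 : (n r d e t : ℕ) → Set
InC0 n r d e t = suc d ≤ t × suc t ≤ e
               × ((S : Seq n r) → ZeroSum S → length S ≡ t → HasShortZS S)

ShortFree : ∀ {n r} → Seq n r → Set
ShortFree S = HasShortZS S → ⊥

PropertyC : ℕ → ℕ → Set
PropertyC n r = Σ ℕ λ c → 1 ≤ c × IsEta n r (c * (n ∸ 1) + 1)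
  × ((S : Seq n r) → ShortFree S → length S ≡ c * (n ∸ 1) →
       Σ (List (Elem n r)) λ gs → length gs ≡ c × Unique gs
         × S ↭ concatMap (replicate (n ∸ 1)) gs)

module Submission where

-- Write n₁ = A + 1 and n₂ = B + 1, so that η(G) = cA·n₂ + η(G₂) = cB·n₁ + η(G₁). Let S be a
-- zero-sum sequence over G of length t ∈ [η(G) − t₁, η(G) − t₂] without short zero-sum
-- subsequences. Splitting off short zero-sum sequences modulo n₂ ("blocks") greedily gives cA
-- disjoint blocks and a remainder R. A further block is impossible: the cA + 1 = η(G₁) quotients
-- σ(B)/n₂ ∈ G₁ of the blocks would contain a short zero-sum subsequence, which lifts to a short
-- zero-sum subsequence of S. So R is short-free modulo n₂ and of length at least η(G₂) − t₁, and
-- the hypothesis on C₀(G₂) leaves only t₂ = 2 and |R| = c(n₂ − 1). Then some block B₀ is shorter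
-- than n₂ and R·B₀ contains no two disjoint blocks. Hence every block of R·B₀ leaves a short-free
-- complement of length c(n₂ − 1), whose multiplicities are multiples of n₂ − 1 by Property C;
-- exchanging an element of B₀ for one of R produces a complement violating this.
-- The same quotient construction gives D(G) ≤ (D(G₂) − 1)·n₁ + η(G₁), whence t > D(G).

open import Defs
open import Data.Nat using (ℕ; zero; suc; _+_; _*_; _∸_; _≤_; _<_; _>_; z≤n; s≤s; s≤s⁻¹; _≤?_; NonZero; _/_; _%_)
open import Data.Nat.Properties
open import Data.Nat.DivMod using (m%n<n; %-distribˡ-+; m%n%n≡m%n; m*[n/m]≡n)
open import Data.Nat.Divisibility
  using ( _∣_; _∣?_; divides; ∣⇒≤; ∣-trans; n∣m*n; m∣m*n; *-monoʳ-∣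
        ; m%n≡0⇒n∣m; n∣m⇒m%n≡0; ∣m∣n⇒∣m+n; ∣m+n∣m⇒∣n)
open import Data.Nat.ListAction using (sum)
open import Data.Nat.ListAction.Properties using (sum-↭; sum-++)
open import Data.Nat.Tactic.RingSolver using (solve-∀)
open import Data.Fin using (Fin; toℕ; fromℕ<)
import Data.Fin.Properties as Fin
open import Data.Vec using (lookup; tabulate)
import Data.Vec as Vec
open import Data.Vec.Properties using (lookup-map; lookup∘tabulate; ≡-dec)
open import Data.List using (List; []; _∷_; _++_; [_]; length; map; concat; filter; replicate; concatMap)
open import Data.List.Properties
  using (map-++; length-map; length-++; length-replicate; concat-++; filter-++; filter-accept; filter-reject; length-filter)
open import Data.List.Membership.Propositional using (_∈_; find)
open import Data.List.Membership.Propositional.Properties using (∈-++⁻; ∈-∃++)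
open import Data.List.Relation.Unary.Any using (here)
open import Data.List.Relation.Unary.All using (All; []; _∷_; all?)
import Data.List.Relation.Unary.All as All
import Data.List.Relation.Unary.All.Properties as Allₚ
open import Data.List.Relation.Binary.Sublist.Propositional using (_⊆_; []; _∷_; _∷ʳ_)
open import Data.List.Relation.Binary.Sublist.Propositional.Properties using (All-resp-⊆) renaming (map⁺ to ⊆-map⁺)
open import Data.List.Relation.Binary.Sublist.Heterogeneous using (minimum)
open import Data.List.Relation.Binary.Permutation.Propositional
  using (_↭_; ↭-refl; ↭-sym; ↭-trans; ↭-reflexive; prep; swap)
open import Data.List.Relation.Binary.Permutation.Propositional.Properties
  using (∈-resp-↭; drop-∷; shift; ↭-length; ++⁺; ++⁺ʳ; ++⁺ˡ; ++-comm; filter-↭; ++-commutativeMonoid)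
  renaming (map⁺ to ↭-map⁺)
open import Data.Product using (∃-syntax; _×_; _,_; proj₁; proj₂)
open import Data.Sum using (_⊎_; inj₁; inj₂)
open import Data.Empty using (⊥; ⊥-elim)
open import Relation.Nullary using (¬_; Dec; yes; no)
open import Relation.Nullary.Decidable using (_×-dec_)
open import Relation.Binary using (Tri; tri<; tri≈; tri>)
open import Relation.Binary.Definitions using (DecidableEquality)
open import Relation.Binary.PropositionalEquality
  using (_≡_; _≢_; refl; sym; trans; cong; cong₂; subst; subst₂; module ≡-Reasoning)

module _ {A : Set} where

  1≤length⇒∷ : ∀ (L : List A) → 1 ≤ length L → ∃[ x ] ∃[ L′ ] L ≡ x ∷ L′
  1≤length⇒∷ (x ∷ L′) _ = x , L′ , refl

  2≤length⇒∷∷ : ∀ (L : List A) → 2 ≤ length L → ∃[ x ] ∃[ x′ ] ∃[ L′ ] L ≡ x ∷ x′ ∷ L′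
  2≤length⇒∷∷ (x ∷ x′ ∷ L′) _ = x , x′ , L′ , refl
  2≤length⇒∷∷ (_ ∷ []) (s≤s ())

  length-concat-full : ∀ {a} (Bs : List (List A)) →
    All (λ B → a ≤ length B) Bs → length Bs * a ≤ length (concat Bs)
  length-concat-full [] [] = z≤n
  length-concat-full (B ∷ Bs) (full ∷ fulls) =
    subst (_ ≤_) (sym (length-++ B)) (+-mono-≤ full (length-concat-full Bs fulls))

-- Sub-multisets and multiplicities

module _ {A : Set} where

  open import Algebra.Solver.CommutativeMonoid (++-commutativeMonoid {A = A})
    using (_⊜_; _⊕_) renaming (solve to solve-↭)

  infix 4 _≼_

  _≼_ : List A → List A → Set
  T ≼ S = ∃[ U ] T ++ U ↭ S

  ≼-trans : ∀ {T S W} → T ≼ S → S ≼ W → T ≼ W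
  ≼-trans {T} (U , p) (U′ , q) = U ++ U′ ,
    ↭-trans (solve-↭ 3 (λ t u u′ → t ⊕ (u ⊕ u′) ⊜ (t ⊕ u) ⊕ u′) ↭-refl T U U′) (↭-trans (++⁺ʳ U′ p) q)

  ⊆⇒≼ : ∀ {T S} → T ⊆ S → T ≼ S
  ⊆⇒≼ [] = [] , ↭-refl
  ⊆⇒≼ {T} (y ∷ʳ σ) with U , p ← ⊆⇒≼ σ =
    y ∷ U , ↭-trans (solve-↭ 3 (λ t y u → t ⊕ (y ⊕ u) ⊜ y ⊕ (t ⊕ u)) ↭-refl T [ y ] U) (prep y p)
  ⊆⇒≼ (refl ∷ σ) with U , p ← ⊆⇒≼ σ = U , prep _ p

  ++-↭-∷⁻ : ∀ {x T U S} → T ++ U ↭ x ∷ S →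
    (∃[ U′ ] T ++ U′ ↭ S) ⊎ (∃[ T′ ] T ↭ x ∷ T′ × T′ ++ U ↭ S)
  ++-↭-∷⁻ {x} {T} {U} p with ∈-++⁻ T (∈-resp-↭ (↭-sym p) (here refl))
  ... | inj₁ x∈T with T₁ , T₂ , refl ← ∈-∃++ x∈T = inj₂ (T₁ ++ T₂ , front , drop-∷ (↭-trans (↭-sym moved) p))
    where
    front : T₁ ++ x ∷ T₂ ↭ x ∷ T₁ ++ T₂
    front = solve-↭ 3 (λ t₁ x t₂ → t₁ ⊕ (x ⊕ t₂) ⊜ x ⊕ (t₁ ⊕ t₂)) ↭-refl T₁ [ x ] T₂
    moved : (T₁ ++ x ∷ T₂) ++ U ↭ x ∷ (T₁ ++ T₂) ++ U
    moved = ++⁺ʳ U front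
  ... | inj₂ x∈U with U₁ , U₂ , refl ← ∈-∃++ x∈U = inj₁ (U₁ ++ U₂ , drop-∷ (↭-trans (↭-sym moved) p))
    where
    moved : T ++ U₁ ++ x ∷ U₂ ↭ x ∷ T ++ U₁ ++ U₂
    moved = solve-↭ 4 (λ t u₁ x u₂ → t ⊕ (u₁ ⊕ (x ⊕ u₂)) ⊜ x ⊕ (t ⊕ (u₁ ⊕ u₂))) ↭-refl T U₁ [ x ] U₂

  ≼⇒⊆ : ∀ {T} S → T ≼ S → ∃[ T′ ] T′ ⊆ S × T′ ↭ T
  ≼⇒⊆ {[]} S _ = [] , minimum S , ↭-refl
  ≼⇒⊆ {T@(_ ∷ _)} [] (U , p) with () ← ↭-length p
  ≼⇒⊆ {T@(_ ∷ _)} (x ∷ S) (U , p) with ++-↭-∷⁻ p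
  ... | inj₁ T≼S with T′ , σ , q ← ≼⇒⊆ S T≼S = T′ , x ∷ʳ σ , q
  ... | inj₂ (T₀ , T↭ , T₀≼S) with T′ , σ , q ← ≼⇒⊆ S (_ , T₀≼S) =
    x ∷ T′ , refl ∷ σ , ↭-trans (prep x q) (↭-sym T↭)

  concat-⊆⇒≼ : ∀ {Bs′ Bs : List (List A)} → Bs′ ⊆ Bs → concat Bs′ ≼ concat Bs
  concat-⊆⇒≼ [] = [] , ↭-refl
  concat-⊆⇒≼ {Bs′} (B ∷ʳ σ) with U , p ← concat-⊆⇒≼ σ = B ++ U ,
    ↭-trans (solve-↭ 3 (λ c b u → c ⊕ (b ⊕ u) ⊜ b ⊕ (c ⊕ u)) ↭-refl (concat Bs′) B U) (++⁺ˡ B p)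
  concat-⊆⇒≼ {B ∷ Bs′} (refl ∷ σ) with U , p ← concat-⊆⇒≼ σ = U ,
    ↭-trans (solve-↭ 3 (λ b c u → (b ⊕ c) ⊕ u ⊜ b ⊕ (c ⊕ u)) ↭-refl B (concat Bs′) U) (++⁺ˡ B p)

  any-sublist? : (P : List A → Set) → (∀ T → Dec (P T)) → ∀ S → Dec (∃[ T ] T ⊆ S × P T)
  any-sublist? P P? [] with P? []
  ... | yes p = yes ([] , [] , p)
  ... | no ¬p = no λ { ([] , [] , p) → ¬p p }
  any-sublist? P P? (x ∷ S) with any-sublist? P P? S | any-sublist? (λ T → P (x ∷ T)) (λ T → P? (x ∷ T)) S
  ... | yes (T , σ , p) | _ = yes (T , x ∷ʳ σ , p)
  ... | no _ | yes (T , σ , p) = yes (x ∷ T , refl ∷ σ , p)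
  ... | no ¬without | no ¬with = no λ
    { (T , (_ ∷ʳ σ) , p) → ¬without (T , σ , p)
    ; (_ ∷ T , (refl ∷ σ) , p) → ¬with (T , σ , p) }

module _ {A B : Set} (f : A → B) where

  ⊆-map-preimage : ∀ {T} S → T ⊆ map f S → ∃[ T′ ] T′ ⊆ S × map f T′ ≡ T
  ⊆-map-preimage [] [] = [] , [] , refl
  ⊆-map-preimage (x ∷ S) (_ ∷ʳ σ) with T′ , σ′ , refl ← ⊆-map-preimage S σ = T′ , x ∷ʳ σ′ , refl
  ⊆-map-preimage (x ∷ S) (refl ∷ σ) with T′ , σ′ , refl ← ⊆-map-preimage S σ = x ∷ T′ , refl ∷ σ′ , refl

  map-≼ : ∀ {T S} → T ≼ S → map f T ≼ map f S
  map-≼ {T} (U , T++U↭S) = map f U , ↭-trans (↭-reflexive (sym (map-++ f T U))) (↭-map⁺ f T++U↭S)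

module Multiplicity {A : Set} (_≟_ : DecidableEquality A) where

  multiplicity : A → List A → ℕ
  multiplicity h xs = length (filter (h ≟_) xs)

  multiplicity-here : ∀ {h x} xs → h ≡ x → multiplicity h (x ∷ xs) ≡ suc (multiplicity h xs)
  multiplicity-here xs h≡x = cong length (filter-accept (_ ≟_) h≡x)

  multiplicity-there : ∀ {h x} xs → h ≢ x → multiplicity h (x ∷ xs) ≡ multiplicity h xs
  multiplicity-there xs h≢x = cong length (filter-reject (_ ≟_) h≢x)

  multiplicity-++ : ∀ h xs ys → multiplicity h (xs ++ ys) ≡ multiplicity h xs + multiplicity h ys
  multiplicity-++ h xs ys = trans (cong length (filter-++ (h ≟_) xs ys)) (length-++ (filter (h ≟_) xs))

  multiplicity-↭ : ∀ h {xs ys} → xs ↭ ys → multiplicity h xs ≡ multiplicity h ys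
  multiplicity-↭ h p = ↭-length (filter-↭ (h ≟_) p)

  multiplicity-≼ : ∀ h {xs ys} → xs ≼ ys → multiplicity h xs ≤ multiplicity h ys
  multiplicity-≼ h {xs} (zs , p) rewrite sym (multiplicity-↭ h p) | multiplicity-++ h xs zs = m≤m+n _ _

  multiplicity-≤-length : ∀ h xs → multiplicity h xs ≤ length xs
  multiplicity-≤-length h = length-filter (h ≟_)

  multiplicity-replicate : ∀ h k g → multiplicity h (replicate k g) ≡ k * multiplicity h [ g ]
  multiplicity-replicate h zero g = refl
  multiplicity-replicate h (suc k) g =
    trans (multiplicity-++ h [ g ] (replicate k g)) (cong (multiplicity h [ g ] +_) (multiplicity-replicate h k g))

  multiplicity-concatMap-replicate : ∀ h k gs → multiplicity h (concatMap (replicate k) gs) ≡ k * multiplicity h gs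
  multiplicity-concatMap-replicate h k [] = sym (*-zeroʳ k)
  multiplicity-concatMap-replicate h k (g ∷ gs) = begin
    multiplicity h (replicate k g ++ concatMap (replicate k) gs)
      ≡⟨ multiplicity-++ h (replicate k g) _ ⟩
    multiplicity h (replicate k g) + multiplicity h (concatMap (replicate k) gs)
      ≡⟨ cong₂ _+_ (multiplicity-replicate h k g) (multiplicity-concatMap-replicate h k gs) ⟩
    k * multiplicity h [ g ] + k * multiplicity h gs
      ≡⟨ sym (*-distribˡ-+ k _ _) ⟩
    k * (multiplicity h [ g ] + multiplicity h gs)
      ≡⟨ cong (k *_) (sym (multiplicity-++ h [ g ] gs)) ⟩
    k * multiplicity h (g ∷ gs) ∎
    where open ≡-Reasoning

  module _ {B : Set} (f : B → A) where

    fiber-≼ : ∀ h k R → k ≤ multiplicity h (map f R) → ∃[ Y ] Y ≼ R × map f Y ≡ replicate k h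
    fiber-≼ h zero R _ = [] , (R , ↭-refl) , refl
    fiber-≼ h (suc k) (x ∷ R) k<m = by-cases (h ≟ f x)
      where
      by-cases : Dec (h ≡ f x) → ∃[ Y ] Y ≼ x ∷ R × map f Y ≡ replicate (suc k) h
      by-cases (yes h≡fx)
        with Y , (U , p) , e ← fiber-≼ h k R (s≤s⁻¹ (subst (suc k ≤_) (multiplicity-here (map f R) h≡fx) k<m)) =
        x ∷ Y , (U , prep x p) , cong₂ _∷_ (sym h≡fx) e
      by-cases (no h≢fx)
        with Y , (U , p) , e ← fiber-≼ h (suc k) R (subst (suc k ≤_) (multiplicity-there (map f R) h≢fx) k<m) =
        Y , (x ∷ U , ↭-trans (shift x Y U) (prep x p)) , e

  ↭-concatMap-replicate⇒∣ : ∀ h k {xs} gs → xs ↭ concatMap (replicate k) gs → k ∣ multiplicity h xs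
  ↭-concatMap-replicate⇒∣ h k gs xs↭ = divides (multiplicity h gs)
    (trans (multiplicity-↭ h xs↭) (trans (multiplicity-concatMap-replicate h k gs) (*-comm k _)))

open module ElemMultiplicity {n r : ℕ} = Multiplicity (≡-dec {A = Fin n} {n = r} Fin._≟_)

-- Sequences over C_N^r, blocks and block decompositions

sum-map-% : ∀ {X : Set} (f : X → ℕ) m .{{_ : NonZero m}} (L : List X) →
  sum (map (λ x → f x % m) L) % m ≡ sum (map f L) % m
sum-map-% f m [] = refl
sum-map-% f m (x ∷ L) = begin
  (f x % m + sum (map (λ x → f x % m) L)) % m
    ≡⟨ %-distribˡ-+ (f x % m) _ m ⟩
  (f x % m % m + sum (map (λ x → f x % m) L) % m) % m
    ≡⟨ cong₂ (λ u v → (u + v) % m) (m%n%n≡m%n (f x) m) (sum-map-% f m L) ⟩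
  (f x % m + sum (map f L) % m) % m
    ≡⟨ sym (%-distribˡ-+ (f x) _ m) ⟩
  (f x + sum (map f L)) % m ∎
  where open ≡-Reasoning

∣-sum-map-%⁺ : ∀ {X : Set} (f : X → ℕ) m .{{_ : NonZero m}} (L : List X) →
  m ∣ sum (map f L) → m ∣ sum (map (λ x → f x % m) L)
∣-sum-map-%⁺ f m L m∣ = m%n≡0⇒n∣m _ m (trans (sum-map-% f m L) (n∣m⇒m%n≡0 _ m m∣))

∣-sum-map-%⁻ : ∀ {X : Set} (f : X → ℕ) m .{{_ : NonZero m}} (L : List X) →
  m ∣ sum (map (λ x → f x % m) L) → m ∣ sum (map f L)
∣-sum-map-%⁻ f m L m∣ = m%n≡0⇒n∣m _ m (trans (sym (sum-map-% f m L)) (n∣m⇒m%n≡0 _ m m∣))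

module _ {N r : ℕ} where

  open import Algebra.Solver.CommutativeMonoid (++-commutativeMonoid {A = Elem N r})
    using (_⊜_; _⊕_) renaming (solve to solve-↭)

  coordSum : Fin r → Seq N r → ℕ
  coordSum i T = sum (map (λ g → toℕ (lookup g i)) T)

  DivisibleBy : ℕ → Seq N r → Set
  DivisibleBy a T = ∀ i → a ∣ coordSum i T

  Block : ℕ → Seq N r → Set
  Block a T = DivisibleBy a T × 1 ≤ length T × length T ≤ a

  TwoDisjointBlocks : ℕ → Seq N r → Set
  TwoDisjointBlocks a W = ∃[ V₁ ] ∃[ V₂ ] ∃[ C ] V₁ ++ V₂ ++ C ↭ W × Block a V₁ × Block a V₂

  coordSum-++ : ∀ i T U → coordSum i (T ++ U) ≡ coordSum i T + coordSum i U
  coordSum-++ i T U = trans (cong sum (map-++ _ T U)) (sum-++ (map _ T) _)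

  coordSum-↭ : ∀ i {T U} → T ↭ U → coordSum i T ≡ coordSum i U
  coordSum-↭ i p = sum-↭ (↭-map⁺ _ p)

  DivisibleBy-↭ : ∀ {a T U} → T ↭ U → DivisibleBy a T → DivisibleBy a U
  DivisibleBy-↭ p a∣ i = subst (_ ∣_) (coordSum-↭ i p) (a∣ i)

  DivisibleBy-++ : ∀ {a} T U → DivisibleBy a T → DivisibleBy a U → DivisibleBy a (T ++ U)
  DivisibleBy-++ T U a∣T a∣U i = subst (_ ∣_) (sym (coordSum-++ i T U)) (∣m∣n⇒∣m+n (a∣T i) (a∣U i))

  DivisibleBy-++⁻ʳ : ∀ {a} T U → DivisibleBy a (T ++ U) → DivisibleBy a T → DivisibleBy a U
  DivisibleBy-++⁻ʳ T U a∣TU a∣T i = ∣m+n∣m⇒∣n (subst (_ ∣_) (coordSum-++ i T U) (a∣TU i)) (a∣T i)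

  DivisibleBy-concat : ∀ {a} Bs → All (Block a) Bs → DivisibleBy a (concat Bs)
  DivisibleBy-concat [] [] i = divides 0 refl
  DivisibleBy-concat (B ∷ Bs) ((a∣B , _) ∷ blocks) = DivisibleBy-++ B (concat Bs) a∣B (DivisibleBy-concat Bs blocks)

  length-concat-blocks : ∀ {a} Bs → All (Block a) Bs → length (concat Bs) ≤ length Bs * a
  length-concat-blocks [] [] = z≤n
  length-concat-blocks (B ∷ Bs) ((_ , _ , short) ∷ blocks) =
    subst (_≤ _) (sym (length-++ B)) (+-mono-≤ short (length-concat-blocks Bs blocks))

  replicate-ZeroSum : (g : Elem N r) → ZeroSum (replicate N g)
  replicate-ZeroSum g i = subst (N ∣_) (sym (sum-replicate N)) (m∣m*n _)
    where
    sum-replicate : ∀ k → coordSum i (replicate k g) ≡ k * toℕ (lookup g i)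
    sum-replicate zero = refl
    sum-replicate (suc k) = cong (toℕ (lookup g i) +_) (sum-replicate k)

  record BlockDecomposition (a : ℕ) (S R : Seq N r) (k : ℕ) : Set where
    constructor decomposition
    field
      blocks    : List (Seq N r)
      #blocks   : length blocks ≡ k
      valid     : All (Block a) blocks
      partition : concat blocks ++ R ↭ S

  open BlockDecomposition public

  cons-block : ∀ {a S R V U k} → V ++ U ↭ S → Block a V → BlockDecomposition a U R k → BlockDecomposition a S R (suc k)
  cons-block {R = R} {V = V} V++U↭S block (decomposition Bs #Bs valid partition) =
    decomposition (V ∷ Bs) (cong suc #Bs) (block ∷ valid)
      (↭-trans (solve-↭ 3 (λ v c r → (v ⊕ c) ⊕ r ⊜ v ⊕ (c ⊕ r)) ↭-refl V (concat Bs) R)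
               (↭-trans (++⁺ˡ V partition) V++U↭S))

  extend-decomposition : ∀ {a S R V U k} → BlockDecomposition a S R k → V ++ U ↭ R → Block a V →
    BlockDecomposition a S U (suc k)
  extend-decomposition {V = V} {U} (decomposition Bs #Bs valid partition) V++U↭R block =
    decomposition (V ∷ Bs) (cong suc #Bs) (block ∷ valid)
      (↭-trans (solve-↭ 3 (λ v c u → (v ⊕ c) ⊕ u ⊜ c ⊕ (v ⊕ u)) ↭-refl V (concat Bs) U)
               (↭-trans (++⁺ˡ (concat Bs) V++U↭R) partition))

  extract-block : ∀ {a S R k B₀} (D : BlockDecomposition a S R k) → B₀ ∈ blocks D →
    ∃[ k′ ] k ≡ suc k′ × Block a B₀ × BlockDecomposition a S (R ++ B₀) k′
  extract-block {R = R} {B₀ = B₀} (decomposition Bs #Bs valid partition) B₀∈Bs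
    with Bs₁ , Bs₂ , refl ← ∈-∃++ B₀∈Bs =
    length (Bs₁ ++ Bs₂) ,
    trans (sym #Bs) (trans (length-++ Bs₁) (trans (+-suc _ _) (cong suc (sym (length-++ Bs₁))))) ,
    All.head (Allₚ.++⁻ʳ Bs₁ valid) ,
    decomposition (Bs₁ ++ Bs₂) refl (Allₚ.++⁺ (Allₚ.++⁻ˡ Bs₁ valid) (All.tail (Allₚ.++⁻ʳ Bs₁ valid)))
      (↭-trans (↭-reflexive (cong (_++ R ++ B₀) (sym (concat-++ Bs₁ Bs₂))))
      (↭-trans (solve-↭ 4 (λ c₁ c₂ r b → (c₁ ⊕ c₂) ⊕ (r ⊕ b) ⊜ (c₁ ⊕ (b ⊕ c₂)) ⊕ r)
                        ↭-refl (concat Bs₁) (concat Bs₂) R B₀)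
      (↭-trans (↭-reflexive (cong (_++ R) (concat-++ Bs₁ (B₀ ∷ Bs₂)))) partition)))

HasShortZS? : ∀ {n r} (S : Seq n r) → Dec (HasShortZS S)
HasShortZS? {n} {r} = any-sublist? _ λ T → ZeroSum? T ×-dec 1 ≤? length T ×-dec length T ≤? Exp n r
  where
  ZeroSum? : (T : Seq n r) → Dec (ZeroSum T)
  ZeroSum? T = Fin.all? λ i → n ∣? coordSum i T

-- Reduction modulo a and quotients of blocks

-- Positive rank is needed: for r = 0, Exp a r = 1, so a block need not be a short zero-sum sequence.
module Reduction {N r : ℕ} (a : ℕ) .{{_ : NonZero a}} where

  reduce : Elem N (suc r) → Elem a (suc r)
  reduce = Vec.map λ x → fromℕ< (m%n<n (toℕ x) a)

  coordSum-map-reduce : ∀ i T → coordSum i (map reduce T) ≡ sum (map (λ g → toℕ (lookup g i) % a) T)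
  coordSum-map-reduce i [] = refl
  coordSum-map-reduce i (g ∷ T) =
    cong₂ _+_ (trans (cong toℕ (lookup-map i _ g)) (Fin.toℕ-fromℕ< _)) (coordSum-map-reduce i T)

  ZeroSum-reduce⁺ : ∀ T → DivisibleBy a T → ZeroSum (map reduce T)
  ZeroSum-reduce⁺ T a∣ i =
    subst (a ∣_) (sym (coordSum-map-reduce i T)) (∣-sum-map-%⁺ (λ g → toℕ (lookup g i)) a T (a∣ i))

  ZeroSum-reduce⁻ : ∀ T → ZeroSum (map reduce T) → DivisibleBy a T
  ZeroSum-reduce⁻ T zs i =
    ∣-sum-map-%⁻ (λ g → toℕ (lookup g i)) a T (subst (a ∣_) (coordSum-map-reduce i T) (zs i))

  block⇒short-zero-sum : ∀ {V} R → V ≼ R → Block a V → HasShortZS (map reduce R)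
  block⇒short-zero-sum R V≼R (a∣V , nonempty , short) with V′ , σ , V′↭V ← ≼⇒⊆ R V≼R =
    let |V′|≡|V| = trans (length-map reduce V′) (↭-length V′↭V) in
    map reduce V′ , ⊆-map⁺ reduce σ , ZeroSum-reduce⁺ V′ (DivisibleBy-↭ (↭-sym V′↭V) a∣V) ,
    subst (1 ≤_) (sym |V′|≡|V|) nonempty , subst (_≤ a) (sym |V′|≡|V|) short

  short-zero-sum⇒block : ∀ R → HasShortZS (map reduce R) → ∃[ V ] V ≼ R × Block a V
  short-zero-sum⇒block R (T , σ , zs , nonempty , short) with V , σ′ , refl ← ⊆-map-preimage reduce R σ =
    V , ⊆⇒≼ σ′ , ZeroSum-reduce⁻ V zs ,
    subst (1 ≤_) (length-map reduce V) nonempty , subst (_≤ a) (length-map reduce V) short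

  greedy-decomposition : ∀ {η} → Threshold a (suc r) HasShortZS η →
    ∀ k (S : Seq N (suc r)) → k * a + η ≤ length S + a → ∃[ R ] BlockDecomposition a S R k
  greedy-decomposition η-threshold zero S _ = S , decomposition [] refl [] ↭-refl
  greedy-decomposition {η} η-threshold (suc k) S long =
    extend (short-zero-sum⇒block S (η-threshold (map reduce S) η≤|S|))
    where
    k*a+η≤|S| : k * a + η ≤ length S
    k*a+η≤|S| = +-cancelˡ-≤ a _ _ (begin
      a + (k * a + η) ≡⟨ sym (+-assoc a (k * a) η) ⟩
      suc k * a + η   ≤⟨ long ⟩
      length S + a    ≡⟨ +-comm (length S) a ⟩
      a + length S    ∎)
      where open ≤-Reasoning
    η≤|S| : η ≤ length (map reduce S)
    η≤|S| = subst (η ≤_) (sym (length-map reduce S)) (≤-trans (m≤n+m η (k * a)) k*a+η≤|S|)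
    rest-long : ∀ {V U} → V ++ U ↭ S → Block a V → k * a + η ≤ length U + a
    rest-long {V} {U} V++U↭S (_ , _ , short) = begin
      k * a + η           ≤⟨ k*a+η≤|S| ⟩
      length S            ≡⟨ sym (↭-length V++U↭S) ⟩
      length (V ++ U)     ≡⟨ length-++ V ⟩
      length V + length U ≤⟨ +-monoˡ-≤ (length U) short ⟩
      a + length U        ≡⟨ +-comm a (length U) ⟩
      length U + a        ∎
      where open ≤-Reasoning
    extend : ∃[ V ] V ≼ S × Block a V → ∃[ R ] BlockDecomposition a S R (suc k)
    extend (V , (U , V++U↭S) , block) =
      let R , D = greedy-decomposition η-threshold k U (rest-long {V} {U} V++U↭S block) in
      R , cons-block V++U↭S block D

module Quotient {N r : ℕ} (a b : ℕ) .{{_ : NonZero a}} .{{_ : NonZero b}} where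

  -- σ(B)/a, for blocks B modulo a: a zero-sum sequence of quotients of blocks of S lifts to a
  -- subsequence of S whose sum is divisible by ab.
  quotient : Seq N r → Elem b r
  quotient B = tabulate λ i → fromℕ< (m%n<n (coordSum i B / a) b)

  coordSum-map-quotient : ∀ i (Bs : List (Seq N r)) →
    coordSum i (map quotient Bs) ≡ sum (map (λ B → (coordSum i B / a) % b) Bs)
  coordSum-map-quotient i [] = refl
  coordSum-map-quotient i (B ∷ Bs) =
    cong₂ _+_ (trans (cong toℕ (lookup∘tabulate _ i)) (Fin.toℕ-fromℕ< _)) (coordSum-map-quotient i Bs)

  coordSum-concat : ∀ i (Bs : List (Seq N r)) → All (Block a) Bs →
    a * sum (map (λ B → coordSum i B / a) Bs) ≡ coordSum i (concat Bs)
  coordSum-concat i [] [] = *-zeroʳ a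
  coordSum-concat i (B ∷ Bs) ((a∣B , _) ∷ valid) = begin
    a * (coordSum i B / a + sum (map (λ B → coordSum i B / a) Bs))
      ≡⟨ *-distribˡ-+ a _ _ ⟩
    a * (coordSum i B / a) + a * sum (map (λ B → coordSum i B / a) Bs)
      ≡⟨ cong₂ _+_ (m*[n/m]≡n (a∣B i)) (coordSum-concat i Bs valid) ⟩
    coordSum i B + coordSum i (concat Bs)
      ≡⟨ sym (coordSum-++ i B (concat Bs)) ⟩
    coordSum i (B ++ concat Bs) ∎
    where open ≡-Reasoning

  ZeroSum-quotients⇒DivisibleBy : ∀ (Bs : List (Seq N r)) → All (Block a) Bs →
    ZeroSum (map quotient Bs) → DivisibleBy (a * b) (concat Bs)
  ZeroSum-quotients⇒DivisibleBy Bs valid zs i =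
    subst (a * b ∣_) (coordSum-concat i Bs valid)
      (*-monoʳ-∣ a (∣-sum-map-%⁻ (λ B → coordSum i B / a) b Bs (subst (b ∣_) (coordSum-map-quotient i Bs) (zs i))))

  lift-zero-sum : ∀ {S R k} (D : BlockDecomposition a S R k) {Ts} →
    Ts ⊆ map quotient (blocks D) → ZeroSum Ts → 1 ≤ length Ts →
    ∃[ T ] T ⊆ S × DivisibleBy (a * b) T × 1 ≤ length T × length T ≤ length Ts * a
  lift-zero-sum {S} {R} (decomposition Bs _ valid partition) σ zs nonempty
    with Bs′ , σ′ , refl ← ⊆-map-preimage quotient Bs σ
    with T , τ , T↭ ← ≼⇒⊆ S (≼-trans (concat-⊆⇒≼ σ′) (R , partition)) =
    let valid′ = All-resp-⊆ σ′ valid in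
    T , τ , DivisibleBy-↭ (↭-sym T↭) (ZeroSum-quotients⇒DivisibleBy Bs′ valid′ zs) ,
    subst (1 ≤_) (sym (↭-length T↭)) (concat-nonempty Bs′ valid′ (subst (1 ≤_) (length-map quotient Bs′) nonempty)) ,
    subst₂ _≤_ (sym (↭-length T↭)) (cong (_* a) (sym (length-map quotient Bs′))) (length-concat-blocks Bs′ valid′)
    where
    concat-nonempty : ∀ Cs → All (Block a) Cs → 1 ≤ length Cs → 1 ≤ length (concat Cs)
    concat-nonempty (C ∷ Cs) ((_ , nonempty , _) ∷ _) _ =
      ≤-trans nonempty (subst (length C ≤_) (sym (length-++ C)) (m≤m+n _ _))

-- Property C and the Davenport constant of G

IsEta-unique : ∀ {n r e e′} → IsEta n r e → IsEta n r e′ → e ≡ e′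
IsEta-unique (is-threshold , minimal) (is-threshold′ , minimal′) =
  ≤-antisym (minimal _ is-threshold′) (minimal′ _ is-threshold)

¬PropertyC-rank-zero : ∀ {n} → 2 ≤ n → ¬ PropertyC n 0
¬PropertyC-rank-zero {suc (suc n′)} _ (c , 1≤c , (_ , minimal) , _) =
  <-irrefl refl (≤-trans (+-monoˡ-≤ 1 (*-mono-≤ 1≤c (s≤s (z≤n {n′})))) (minimal 1 singleton-threshold))
  where
  singleton-threshold : Threshold (suc (suc n′)) 0 HasShortZS 1
  singleton-threshold (x ∷ S) _ = x ∷ [] , refl ∷ minimum S , (λ ()) , s≤s z≤n , s≤s z≤n
¬PropertyC-rank-zero {suc zero} (s≤s ())

PropertyC⇒multiplicities : ∀ {B r c} → 1 ≤ B → IsEta (suc B) r (c * B + 1) → PropertyC (suc B) r →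
  1 ≤ c * B × (∀ T → ShortFree T → length T ≡ c * B → ∀ h → B ∣ multiplicity h T)
PropertyC⇒multiplicities {B} {r} {c} 1≤B η (c′ , 1≤c′ , η′ , shape) =
  subst (1 ≤_) c′B≡cB (*-mono-≤ 1≤c′ 1≤B) ,
  λ T short-free |T| h →
    let gs , _ , _ , T↭ = shape T short-free (trans |T| (sym c′B≡cB)) in ↭-concatMap-replicate⇒∣ h B gs T↭
  where
  c′B≡cB : c′ * B ≡ c * B
  c′B≡cB = +-cancelʳ-≡ 1 _ _ (IsEta-unique η′ η)

module _ {r n₁ n₂ : ℕ} .{{_ : NonZero n₁}} .{{_ : NonZero n₂}} where

  open Reduction {n₁ * n₂} {r} n₁ using (greedy-decomposition)
  open Quotient {n₁ * n₂} {suc r} n₁ n₂ using (quotient; lift-zero-sum)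

  davenport-product-threshold : ∀ {e₁ d₂} →
    Threshold n₁ (suc r) HasShortZS e₁ → Threshold n₂ (suc r) HasNonemptyZS (suc d₂) →
    Threshold (n₁ * n₂) (suc r) HasNonemptyZS (d₂ * n₁ + e₁)
  davenport-product-threshold {e₁} {d₂} η₁ D₂ S long =
    lift (D₂ (map quotient (blocks D)) (≤-reflexive (sym (trans (length-map quotient (blocks D)) (#blocks D)))))
    where
    R,D : ∃[ R ] BlockDecomposition n₁ S R (suc d₂)
    R,D = greedy-decomposition η₁ (suc d₂) S (begin
      n₁ + d₂ * n₁ + e₁   ≡⟨ +-assoc n₁ _ e₁ ⟩
      n₁ + (d₂ * n₁ + e₁) ≤⟨ +-monoʳ-≤ n₁ long ⟩
      n₁ + length S       ≡⟨ +-comm n₁ _ ⟩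
      length S + n₁       ∎)
      where open ≤-Reasoning
    D : BlockDecomposition n₁ S (proj₁ R,D) (suc d₂)
    D = proj₂ R,D
    lift : HasNonemptyZS (map quotient (blocks D)) → HasNonemptyZS S
    lift (Ts , σ , zs , nonempty) =
      let T , τ , n₁n₂∣T , nonempty′ , _ = lift-zero-sum D σ zs nonempty in T , τ , n₁n₂∣T , nonempty′

module _ {r n₁ n₂ : ℕ} .{{_ : NonZero n₁}} .{{_ : NonZero n₂}} where

  open Quotient {n₁ * n₂} {suc r} n₂ n₁ using (quotient; lift-zero-sum)

  short-zero-sum-from-blocks : ∀ {e₁} {S R : Seq (n₁ * n₂) (suc r)} →
    Threshold n₁ (suc r) HasShortZS e₁ → BlockDecomposition n₂ S R e₁ → HasShortZS S
  short-zero-sum-from-blocks η₁ D =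
    lift (η₁ (map quotient (blocks D)) (≤-reflexive (sym (trans (length-map quotient (blocks D)) (#blocks D)))))
    where
    lift : HasShortZS (map quotient (blocks D)) → HasShortZS _
    lift (Ts , σ , zs , nonempty , short) =
      let T , τ , n₂n₁∣T , nonempty′ , |T|≤ = lift-zero-sum D σ zs nonempty in
      T , τ , (λ i → subst (_∣ coordSum i T) (*-comm n₂ n₁) (n₂n₁∣T i)) , nonempty′ , ≤-trans |T|≤ (*-monoˡ-≤ n₂ short)

-- D(G) ≤ (D(G₂) − 1)·n₁ + η(G₁), with the subtraction moved to the left.
davenport-product-bound : ∀ {r n₁ n₂ e₁ d₂ d} .{{_ : NonZero n₁}} .{{_ : NonZero n₂}} →
  IsEta n₁ (suc r) e₁ → IsD n₂ (suc r) d₂ → IsD (n₁ * n₂) (suc r) d → d + n₁ ≤ d₂ * n₁ + e₁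
davenport-product-bound {d₂ = zero} _ (D₂ , _) _ with _ , [] , _ , () ← D₂ [] z≤n
davenport-product-bound {n₁ = n₁} {e₁ = e₁} {d₂ = suc d₂′} {d = d} (η₁ , _) (D₂ , _) (_ , minimal) = begin
  d + n₁                ≤⟨ +-monoˡ-≤ n₁ (minimal _ (davenport-product-threshold η₁ D₂)) ⟩
  d₂′ * n₁ + e₁ + n₁    ≡⟨ regroup n₁ d₂′ e₁ ⟩
  suc d₂′ * n₁ + e₁     ∎
  where
  open ≤-Reasoning
  regroup : ∀ n d e → d * n + e + n ≡ suc d * n + e
  regroup = solve-∀

η-split : ∀ c A B → c * (B + A * suc B) + 1 ≡ c * A * suc B + (c * B + 1)
η-split = solve-∀

η-split₁ : ∀ c A B → c * (B + A * suc B) + 1 ≡ c * B * suc A + (c * A + 1)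
η-split₁ = solve-∀

davenport-window : ∀ {n₁ d d₂ e₁ t K} .{{_ : NonZero n₁}} →
  d + n₁ ≤ d₂ * n₁ + e₁ → suc d₂ + t ≤ K + 1 → suc d + t ≤ K * n₁ + e₁
davenport-window {n₁} {d} {d₂} {e₁} {t} {K} d-bound d₂-bound = +-cancelʳ-≤ n₁ _ _ (begin
  suc d + t + n₁               ≡⟨ regroup₁ n₁ d t ⟩
  (d + n₁) + suc t             ≤⟨ +-monoˡ-≤ (suc t) d-bound ⟩
  d₂ * n₁ + e₁ + suc t         ≤⟨ +-monoʳ-≤ (d₂ * n₁ + e₁) (m≤m*n (suc t) n₁) ⟩
  d₂ * n₁ + e₁ + suc t * n₁    ≡⟨ regroup₂ n₁ d₂ e₁ t ⟩
  (suc d₂ + t) * n₁ + e₁       ≤⟨ +-monoˡ-≤ e₁ (*-monoˡ-≤ n₁ d₂-bound) ⟩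
  (K + 1) * n₁ + e₁            ≡⟨ regroup₃ n₁ K e₁ ⟩
  K * n₁ + e₁ + n₁             ∎)
  where
  open ≤-Reasoning
  regroup₁ : ∀ n d t → suc d + t + n ≡ (d + n) + suc t
  regroup₁ = solve-∀
  regroup₂ : ∀ n d e t → d * n + e + suc t * n ≡ (suc d + t) * n + e
  regroup₂ = solve-∀
  regroup₃ : ∀ n K e → (K + 1) * n + e ≡ K * n + e + n
  regroup₃ = solve-∀

positive-≤-∸⇒+≤ : ∀ {m n o} → 1 ≤ m → m ≤ o ∸ n → m + n ≤ o
positive-≤-∸⇒+≤ {m} {n} {o} 1≤m m≤o∸n = m≤o∸n⇒m+n≤o m (<⇒≤ (m∸n≢0⇒n<m o∸n≢0)) m≤o∸n
  where
  o∸n≢0 : o ∸ n ≢ 0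
  o∸n≢0 o∸n≡0 = 1+n≰n (≤-trans 1≤m (subst (m ≤_) o∸n≡0 m≤o∸n))

1-or-2⇒1≤ : ∀ {t} → t ≡ 1 ⊎ t ≡ 2 → 1 ≤ t
1-or-2⇒1≤ (inj₁ refl) = s≤s z≤n
1-or-2⇒1≤ (inj₂ refl) = s≤s z≤n

∸⇒≤+ : ∀ {m n o} → m ∸ n ≤ o → m ≤ o + n
∸⇒≤+ {m} {n} {o} m∸n≤o = subst (m ≤_) (+-comm n o) (≤-trans (m≤n+m∸n m n) (+-monoʳ-≤ n m∸n≤o))

<-∸-positive : ∀ {t X u} → 1 ≤ u → t ≤ (X + 1) ∸ u → t < X + 1
<-∸-positive {t} {X} {u} 1≤u t≤ = subst (t <_) (+-comm 1 X) (s≤s (≤-trans t≤ X+1∸u≤X))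
  where
  X+1∸u≤X : (X + 1) ∸ u ≤ X
  X+1∸u≤X = subst ((X + 1) ∸ u ≤_) (m+n∸n≡m X 1) (∸-monoʳ-≤ (X + 1) 1≤u)

∸-window : ∀ {K t x} → t ≡ 1 ⊎ t ≡ 2 → (K + 1) ∸ t < x → x < K + 1 → t ≡ 2 × x ≡ K
∸-window {K} {x = x} (inj₁ refl) K<x x<K+1 =
  ⊥-elim (<⇒≱ (subst (_< x) (m+n∸n≡m K 1) K<x) (s≤s⁻¹ (subst (x <_) (+-comm K 1) x<K+1)))
∸-window {K} {x = x} (inj₂ refl) K∸1<x x<K+1 =
  refl , ≤-antisym (s≤s⁻¹ (subst (x <_) (+-comm K 1) x<K+1)) (s≤s⁻¹ (begin
  suc K              ≡⟨ +-comm 1 K ⟩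
  K + 1              ≤⟨ m≤n+m∸n (K + 1) 2 ⟩
  2 + ((K + 1) ∸ 2)  ≤⟨ s≤s K∸1<x ⟩
  suc x              ∎))
  where open ≤-Reasoning

∸2-gap : ∀ {X s} → 1 ≤ X → X ≤ s → s ≤ (X + 1) ∸ 2 → ⊥
∸2-gap {suc X′} _ X≤s s≤ = 1+n≰n (≤-trans X≤s (subst (_ ≤_) (m+n∸n≡m X′ 1) s≤))

short-block-long : ∀ n k′ K m t L → L ≤ k′ * n → suc k′ * n + (K + 1) ≤ L + (K + m) + t → suc n ≤ m + t
short-block-long n k′ K m t L L≤ lower = +-cancelˡ-≤ (k′ * n + K) _ _ (begin
  k′ * n + K + suc n      ≡⟨ regroupˡ n k′ K ⟩
  suc k′ * n + (K + 1)    ≤⟨ lower ⟩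
  L + (K + m) + t         ≤⟨ +-monoˡ-≤ t (+-monoˡ-≤ (K + m) L≤) ⟩
  k′ * n + (K + m) + t    ≡⟨ regroupʳ (k′ * n) K m t ⟩
  k′ * n + K + (m + t)    ∎)
  where
  open ≤-Reasoning
  regroupˡ : ∀ n k K → k * n + K + suc n ≡ suc k * n + (K + 1)
  regroupˡ = solve-∀
  regroupʳ : ∀ x K m t → x + (K + m) + t ≡ x + K + (m + t)
  regroupʳ = solve-∀

-- The case of a short block

module ShortBlock
  {N r B c t₁ : ℕ} (2≤B : 2 ≤ B) (t₁≤B : t₁ ≤ B)
  (η₂ : Threshold (suc B) (suc r) HasShortZS (c * B + 1))
  (C₀ : ∀ (T : Seq (suc B) (suc r)) →
    (c * B + 1) ∸ t₁ ≤ length T → length T ≤ (c * B + 1) ∸ 2 → ZeroSum T → HasShortZS T)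
  (B∣multiplicities : ∀ (T : Seq (suc B) (suc r)) → ShortFree T → length T ≡ c * B → ∀ h → B ∣ multiplicity h T)
  (1≤cB : 1 ≤ c * B)
  (R B₀ : Seq N (suc r)) (n∣R : DivisibleBy (suc B) R) (B₀-block : Block (suc B) B₀)
  (R-length : length R ≡ c * B) (B₀-short : length B₀ < suc B) (B₀-long : suc (suc B) ≤ length B₀ + t₁)
  where

  open Reduction {N} {r} (suc B) using (reduce; ZeroSum-reduce⁺; ZeroSum-reduce⁻; block⇒short-zero-sum; short-zero-sum⇒block)
  open import Algebra.Solver.CommutativeMonoid (++-commutativeMonoid {A = Elem N (suc r)})
    using (_⊜_; _⊕_) renaming (solve to solve-↭)

  m : ℕ
  m = length B₀

  2≤m : 2 ≤ m
  2≤m = +-cancelʳ-≤ t₁ 2 m (≤-trans (+-monoʳ-≤ 2 t₁≤B) B₀-long)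

  module _ (no-two : ¬ TwoDisjointBlocks (suc B) (R ++ B₀)) where

    -- |V| + |C| = cB + m and C is short-free modulo n₂, so η(G₂) excludes |V| < m and the
    -- hypothesis on C₀(G₂) excludes |V| > m.
    block-complement : ∀ V C → V ++ C ↭ R ++ B₀ → Block (suc B) V →
      length V ≡ m × length C ≡ c * B × ShortFree (map reduce C)
    block-complement V C V++C↭ V-block@(n∣V , _ , V≤n) = by-length (<-cmp (length V) m)
      where
      open ≤-Reasoning
      length-map-reduce : ∀ {P : ℕ → Set} → P (length C) → P (length (map reduce C))
      length-map-reduce {P} = subst P (sym (length-map reduce C))
      V+C-length : length V + length C ≡ c * B + m
      V+C-length = trans (sym (length-++ V)) (trans (↭-length V++C↭) (trans (length-++ R) (cong (_+ m) R-length)))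
      n∣C : DivisibleBy (suc B) C
      n∣C = DivisibleBy-++⁻ʳ V C (DivisibleBy-↭ (↭-sym V++C↭) (DivisibleBy-++ R B₀ n∣R (proj₁ B₀-block))) n∣V
      short-free : ShortFree (map reduce C)
      short-free hs with V₂ , (C′ , V₂++C′↭C) , V₂-block ← short-zero-sum⇒block C hs =
        no-two (V , V₂ , C′ , ↭-trans (++⁺ˡ V V₂++C′↭C) V++C↭ , V-block , V₂-block)
      C-long : length V < m → c * B + 1 ≤ length C
      C-long V<m = subst (_≤ length C) (+-comm 1 _) (+-cancelʳ-< m _ _ (begin-strict
        c * B + m           ≡⟨ sym V+C-length ⟩
        length V + length C <⟨ +-monoˡ-< (length C) V<m ⟩
        m + length C        ≡⟨ +-comm m _ ⟩
        length C + m        ∎))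
      C-upper : m < length V → length C ≤ (c * B + 1) ∸ 2
      C-upper m<V = m+n≤o⇒m≤o∸n _ (subst (_≤ c * B + 1) (sym (+-suc (length C) 1))
        (+-monoˡ-≤ 1 (+-cancelʳ-< m _ _ (begin-strict
        length C + m        <⟨ +-monoʳ-< (length C) m<V ⟩
        length C + length V ≡⟨ +-comm (length C) _ ⟩
        length V + length C ≡⟨ V+C-length ⟩
        c * B + m           ∎))))
      C-lower : (c * B + 1) ∸ t₁ ≤ length C
      C-lower = m≤n+o⇒m∸n≤o _ t₁ (+-cancelˡ-≤ m _ _ (begin
        m + (c * B + 1)           ≡⟨ cong (m +_) (+-comm (c * B) 1) ⟩
        m + suc (c * B)           ≡⟨ +-suc m _ ⟩
        suc (m + c * B)           ≡⟨ cong suc (trans (+-comm m _) (sym V+C-length)) ⟩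
        suc (length V + length C) ≤⟨ s≤s (+-monoˡ-≤ (length C) V≤n) ⟩
        suc (suc B) + length C    ≤⟨ +-monoˡ-≤ (length C) B₀-long ⟩
        m + t₁ + length C         ≡⟨ +-assoc m t₁ _ ⟩
        m + (t₁ + length C)       ∎))
      by-length : Tri (length V < m) (length V ≡ m) (length V > m) →
        length V ≡ m × length C ≡ c * B × ShortFree (map reduce C)
      by-length (tri< V<m _ _) = ⊥-elim (short-free (η₂ (map reduce C) (length-map-reduce {c * B + 1 ≤_} (C-long V<m))))
      by-length (tri≈ _ V≡m _) =
        V≡m , +-cancelˡ-≡ m _ _ (trans (cong (_+ length C) (sym V≡m)) (trans V+C-length (+-comm _ m))) , short-free
      by-length (tri> _ _ m<V) = ⊥-elim (short-free
        (C₀ (map reduce C) (length-map-reduce {(c * B + 1) ∸ t₁ ≤_} C-lower)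
            (length-map-reduce {_≤ (c * B + 1) ∸ 2} (C-upper m<V)) (ZeroSum-reduce⁺ C n∣C)))

    R-short-free : ShortFree (map reduce R)
    R-short-free = proj₂ (proj₂ (block-complement B₀ R (++-comm B₀ R) B₀-block))

    -- Otherwise R contains B copies of the class of z, which together with z form a block of
    -- length n₂ ≠ m.
    absent-from-R : ∀ {z B′} → B₀ ↭ z ∷ B′ → multiplicity (reduce z) (map reduce R) ≡ 0
    absent-from-R {z} {B′} B₀↭ = by-multiplicity _ refl
      where
      B∣multiplicity : B ∣ multiplicity (reduce z) (map reduce R)
      B∣multiplicity = B∣multiplicities (map reduce R) R-short-free (trans (length-map reduce R) R-length) (reduce z)
      full-block : ∃[ Y ] Y ≼ R × map reduce Y ≡ replicate B (reduce z) → ⊥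
      full-block (Y , (R″ , Y++R″↭R) , Y-values) = <-irrefl (sym (trans (cong suc |Y|) (proj₁ complement))) B₀-short
        where
        |Y| : B ≡ length Y
        |Y| = sym (trans (sym (length-map reduce Y)) (trans (cong length Y-values) (length-replicate B)))
        block : Block (suc B) (z ∷ Y)
        block = ZeroSum-reduce⁻ (z ∷ Y) (subst ZeroSum (sym (cong (reduce z ∷_) Y-values)) (replicate-ZeroSum (reduce z))) ,
                s≤s z≤n , ≤-reflexive (cong suc (sym |Y|))
        complement : length (z ∷ Y) ≡ m × length (R″ ++ B′) ≡ c * B × ShortFree (map reduce (R″ ++ B′))
        complement = block-complement (z ∷ Y) (R″ ++ B′)
          (↭-trans (solve-↭ 4 (λ z y r b → (z ⊕ y) ⊕ (r ⊕ b) ⊜ (y ⊕ r) ⊕ (z ⊕ b)) ↭-refl [ z ] Y R″ B′)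
                   (++⁺ Y++R″↭R (↭-sym B₀↭))) block
      by-multiplicity : ∀ k → multiplicity (reduce z) (map reduce R) ≡ k → multiplicity (reduce z) (map reduce R) ≡ 0
      by-multiplicity zero eq = eq
      by-multiplicity (suc k) eq = ⊥-elim (full-block (fiber-≼ reduce (reduce z) B R
        (≤-trans (∣⇒≤ (subst (B ∣_) eq B∣multiplicity)) (≤-reflexive (sym eq)))))

    -- In x ∷ R′ the class of x occurs once, so by Property C x ∷ R′ is not short-free. A block in
    -- it either lies in R, or contains x and leaves the complement U ++ y ∷ x′ ∷ B″, in which the
    -- class of x′ occurs between 1 and m − 1 < B times.
    module Exchange {x x′ B″ y R′} (B₀↭ : B₀ ↭ x ∷ x′ ∷ B″) (R↭ : R ↭ y ∷ R′) where

      R′≼R : R′ ≼ R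
      R′≼R = [ y ] , ↭-trans (++-comm R′ [ y ]) (↭-sym R↭)

      absent-from-R′ : ∀ {h} → multiplicity h (map reduce R) ≡ 0 → multiplicity h (map reduce R′) ≡ 0
      absent-from-R′ {h} absent = n≤0⇒n≡0 (subst (_ ≤_) absent (multiplicity-≼ h (map-≼ reduce R′≼R)))

      x′-absent : multiplicity (reduce x′) (map reduce R) ≡ 0
      x′-absent = absent-from-R (↭-trans B₀↭ (swap x x′ ↭-refl))

      x′≢y : reduce x′ ≢ reduce y
      x′≢y x′≡y = 0≢1+n (trans (sym x′-absent)
        (trans (multiplicity-↭ (reduce x′) (↭-map⁺ reduce R↭)) (multiplicity-here (map reduce R′) x′≡y)))

      x∷R′-length : length (map reduce (x ∷ R′)) ≡ c * B
      x∷R′-length = trans (length-map reduce (x ∷ R′)) (trans (sym (↭-length R↭)) R-length)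

      x-in-block : ∀ {V U V′} → Block (suc B) V → V ↭ x ∷ V′ → V′ ++ U ↭ R′ → ⊥
      x-in-block {V} {U} {V′} V-block V↭ V′++U↭R′ = <-irrefl refl (begin-strict
        B                                              ≤⟨ ∣⇒≤ (subst (B ∣_) x′-count B∣x′-count) ⟩
        suc (multiplicity (reduce x′) (map reduce B″)) ≤⟨ s≤s (multiplicity-≤-length _ (map reduce B″)) ⟩
        suc (length (map reduce B″))                   ≡⟨ cong suc (length-map reduce B″) ⟩
        suc (length B″)                                <⟨ s≤s⁻¹ (subst (_< suc B) (↭-length B₀↭) B₀-short) ⟩
        B                                              ∎)
        where
        open ≤-Reasoning
        C : Seq N (suc r)
        C = U ++ y ∷ x′ ∷ B″
        V++C↭ : V ++ C ↭ R ++ B₀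
        V++C↭ = ↭-trans (++⁺ʳ C V↭) (↭-trans
          (solve-↭ 6 (λ x v u y x′ b → (x ⊕ v) ⊕ (u ⊕ (y ⊕ (x′ ⊕ b))) ⊜ (y ⊕ (v ⊕ u)) ⊕ (x ⊕ (x′ ⊕ b)))
                 ↭-refl [ x ] V′ U [ y ] [ x′ ] B″)
          (++⁺ (↭-trans (prep y V′++U↭R′) (↭-sym R↭)) (↭-sym B₀↭)))
        complement : length V ≡ m × length C ≡ c * B × ShortFree (map reduce C)
        complement = block-complement V C V++C↭ V-block
        B∣x′-count : B ∣ multiplicity (reduce x′) (map reduce C)
        B∣x′-count = B∣multiplicities (map reduce C) (proj₂ (proj₂ complement))
          (trans (length-map reduce C) (proj₁ (proj₂ complement))) (reduce x′)
        x′-absent-from-U : multiplicity (reduce x′) (map reduce U) ≡ 0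
        x′-absent-from-U = n≤0⇒n≡0 (subst (_ ≤_) (absent-from-R′ x′-absent)
          (multiplicity-≼ (reduce x′) (map-≼ reduce (V′ , ↭-trans (++-comm U V′) V′++U↭R′))))
        x′-count : multiplicity (reduce x′) (map reduce C) ≡ suc (multiplicity (reduce x′) (map reduce B″))
        x′-count = begin-equality
          multiplicity (reduce x′) (map reduce C)
            ≡⟨ cong (multiplicity (reduce x′)) (map-++ reduce U (y ∷ x′ ∷ B″)) ⟩
          multiplicity (reduce x′) (map reduce U ++ map reduce (y ∷ x′ ∷ B″))
            ≡⟨ multiplicity-++ (reduce x′) (map reduce U) _ ⟩
          multiplicity (reduce x′) (map reduce U) + multiplicity (reduce x′) (map reduce (y ∷ x′ ∷ B″))
            ≡⟨ cong₂ _+_ x′-absent-from-U (multiplicity-there (map reduce (x′ ∷ B″)) x′≢y) ⟩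
          multiplicity (reduce x′) (map reduce (x′ ∷ B″))
            ≡⟨ multiplicity-here (map reduce B″) refl ⟩
          suc (multiplicity (reduce x′) (map reduce B″)) ∎

      by-position : ∀ {V U} → Block (suc B) V →
        (∃[ U′ ] V ++ U′ ↭ R′) ⊎ (∃[ V′ ] V ↭ x ∷ V′ × V′ ++ U ↭ R′) → ⊥
      by-position V-block (inj₁ V≼R′) = R-short-free (block⇒short-zero-sum R (≼-trans V≼R′ R′≼R) V-block)
      by-position V-block (inj₂ (V′ , V↭ , V′++U↭R′)) = x-in-block V-block V↭ V′++U↭R′

      by-cases : Dec (HasShortZS (map reduce (x ∷ R′))) → ⊥
      by-cases (no short-free) =
        <-irrefl refl (≤-trans 2≤B (∣⇒≤ (subst (B ∣_) count (B∣multiplicities _ short-free x∷R′-length (reduce x)))))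
        where
        count : multiplicity (reduce x) (map reduce (x ∷ R′)) ≡ 1
        count = trans (multiplicity-here {h = reduce x} (map reduce R′) refl) (cong suc (absent-from-R′ (absent-from-R B₀↭)))
      by-cases (yes has-short) with V , (U , V++U↭) , V-block ← short-zero-sum⇒block (x ∷ R′) has-short =
        by-position {V} {U} V-block (++-↭-∷⁻ V++U↭)

      absurd : ⊥
      absurd = by-cases (HasShortZS? (map reduce (x ∷ R′)))

    absurd : ⊥
    absurd =
      let x , x′ , B″ , B₀≡ = 2≤length⇒∷∷ B₀ 2≤m
          y , R′ , R≡ = 1≤length⇒∷ R (subst (1 ≤_) (sym R-length) 1≤cB)
      in Exchange.absurd (↭-reflexive B₀≡) (↭-reflexive R≡)

  ¬¬two-disjoint-blocks : ¬ ¬ TwoDisjointBlocks (suc B) (R ++ B₀)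
  ¬¬two-disjoint-blocks = absurd

-- Zero-sum sequences of length near η(G)

module NearEta
  {r A B c t₁ t₂ : ℕ} (t₂≤t₁ : t₂ ≤ t₁) (t₁≤B : t₁ ≤ B) (t₂∈ : t₂ ≡ 1 ⊎ t₂ ≡ 2)
  (η₁ : Threshold (suc A) (suc r) HasShortZS (c * A + 1))
  (η₂ : Threshold (suc B) (suc r) HasShortZS (c * B + 1))
  (1≤cB : 1 ≤ c * B)
  (B∣multiplicities : ∀ (T : Seq (suc B) (suc r)) → ShortFree T → length T ≡ c * B → ∀ h → B ∣ multiplicity h T)
  (C₀ : ∀ (T : Seq (suc B) (suc r)) →
    (c * B + 1) ∸ t₁ ≤ length T → length T ≤ (c * B + 1) ∸ t₂ → ZeroSum T → HasShortZS T)
  (S : Seq (suc A * suc B) (suc r)) (zero-sum : ZeroSum S)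
  (lower : c * (B + A * suc B) + 1 ≤ length S + t₁) (upper : length S ≤ (c * (B + A * suc B) + 1) ∸ t₂)
  (short-free : ShortFree S)
  where

  open Reduction {suc A * suc B} {r} (suc B) using (reduce; ZeroSum-reduce⁺; greedy-decomposition; short-zero-sum⇒block)

  k : ℕ
  k = c * A

  lower′ : k * suc B + (c * B + 1) ≤ length S + t₁
  lower′ = subst (_≤ length S + t₁) (η-split c A B) lower

  no-extra-block : ∀ {R} → BlockDecomposition (suc B) S R (suc k) → ⊥
  no-extra-block D = short-free (short-zero-sum-from-blocks η₁ (subst (BlockDecomposition (suc B) S _) (+-comm 1 k) D))

  module Remainder {R} (D : BlockDecomposition (suc B) S R k) where

    open ≤-Reasoning

    S-length : length (concat (blocks D)) + length R ≡ length S
    S-length = trans (sym (length-++ (concat (blocks D)))) (↭-length (partition D))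

    blocks-short : length (concat (blocks D)) ≤ k * suc B
    blocks-short = subst (λ j → length (concat (blocks D)) ≤ j * suc B) (#blocks D) (length-concat-blocks (blocks D) (valid D))

    n∣R : DivisibleBy (suc B) R
    n∣R = DivisibleBy-++⁻ʳ (concat (blocks D)) R
      (DivisibleBy-↭ (↭-sym (partition D)) λ i → ∣-trans (n∣m*n (suc A)) (zero-sum i))
      (DivisibleBy-concat (blocks D) (valid D))

    R-short-free : ShortFree (map reduce R)
    R-short-free hs = let V , (U , V++U↭R) , block = short-zero-sum⇒block R hs in
      no-extra-block (extend-decomposition {V = V} {U = U} D V++U↭R block)

    R-lower : c * B + 1 ≤ length R + t₁
    R-lower = +-cancelˡ-≤ (k * suc B) _ _ (begin
      k * suc B + (c * B + 1)                   ≤⟨ lower′ ⟩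
      length S + t₁                             ≡⟨ cong (_+ t₁) (sym S-length) ⟩
      length (concat (blocks D)) + length R + t₁ ≤⟨ +-monoˡ-≤ t₁ (+-monoˡ-≤ (length R) blocks-short) ⟩
      k * suc B + length R + t₁                 ≡⟨ +-assoc (k * suc B) (length R) t₁ ⟩
      k * suc B + (length R + t₁)               ∎)

    R-upper : length R < c * B + 1
    R-upper = ≰⇒> λ long → R-short-free (η₂ (map reduce R) (subst (_ ≤_) (sym (length-map reduce R)) long))

    R-window : t₂ ≡ 2 × length R ≡ c * B
    R-window with length R ≤? (c * B + 1) ∸ t₂
    ... | yes short = ⊥-elim (R-short-free (C₀ (map reduce R)
      (subst ((c * B + 1) ∸ t₁ ≤_) (sym (length-map reduce R))
        (m≤n+o⇒m∸n≤o _ t₁ (subst (c * B + 1 ≤_) (+-comm (length R) t₁) R-lower)))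
      (subst (_≤ (c * B + 1) ∸ t₂) (sym (length-map reduce R)) short)
      (ZeroSum-reduce⁺ R n∣R)))
    ... | no long = ∸-window t₂∈ (≰⇒> long) R-upper

    all-full : All (λ B′ → suc B ≤ length B′) (blocks D) → ⊥
    all-full full = ∸2-gap (≤-trans 1≤cB (m≤n+m _ _)) (begin
      k * suc B + c * B                         ≤⟨ +-mono-≤ blocks-long (≤-reflexive (sym (proj₂ R-window))) ⟩
      length (concat (blocks D)) + length R     ≡⟨ S-length ⟩
      length S                                  ∎)
      (subst₂ (λ j t → length S ≤ j ∸ t) (trans (η-split c A B) (sym (+-assoc (k * suc B) (c * B) 1)))
              (proj₁ R-window) upper)
      where
      blocks-long : k * suc B ≤ length (concat (blocks D))
      blocks-long = subst (λ j → j * suc B ≤ length (concat (blocks D))) (#blocks D) (length-concat-full (blocks D) full)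

    short-block : ∀ {k′ B₀} → k ≡ suc k′ → Block (suc B) B₀ → BlockDecomposition (suc B) S (R ++ B₀) k′ →
      length B₀ < suc B → ⊥
    short-block {k′} {B₀} k≡ B₀-block D′ B₀-short =
      ShortBlock.¬¬two-disjoint-blocks {c = c} 2≤B t₁≤B η₂ C₀′ B∣multiplicities 1≤cB R B₀ n∣R B₀-block
        (proj₂ R-window) B₀-short B₀-long no-two
      where
      2≤B : 2 ≤ B
      2≤B = ≤-trans (subst (_≤ t₁) (proj₁ R-window) t₂≤t₁) t₁≤B
      C₀′ : ∀ (T : Seq (suc B) (suc r)) →
        (c * B + 1) ∸ t₁ ≤ length T → length T ≤ (c * B + 1) ∸ 2 → ZeroSum T → HasShortZS T
      C₀′ T lo hi = C₀ T lo (subst (λ t → length T ≤ (c * B + 1) ∸ t) (sym (proj₁ R-window)) hi)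
      no-two : ¬ TwoDisjointBlocks (suc B) (R ++ B₀)
      no-two (V₁ , V₂ , C , V₁++V₂++C↭ , V₁-block , V₂-block) =
        no-extra-block (subst (BlockDecomposition (suc B) S C) (sym (cong suc k≡))
          (extend-decomposition {V = V₂} {U = C}
            (extend-decomposition {V = V₁} D′ V₁++V₂++C↭ V₁-block) ↭-refl V₂-block))
      S-length′ : length (concat (blocks D′)) + (c * B + length B₀) ≡ length S
      S-length′ = trans
        (cong (length (concat (blocks D′)) +_) (trans (cong (_+ length B₀) (sym (proj₂ R-window))) (sym (length-++ R))))
        (trans (sym (length-++ (concat (blocks D′)))) (↭-length (partition D′)))
      B₀-long : suc (suc B) ≤ length B₀ + t₁
      B₀-long = short-block-long (suc B) k′ (c * B) (length B₀) t₁ (length (concat (blocks D′)))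
        (subst (λ j → length (concat (blocks D′)) ≤ j * suc B) (#blocks D′) (length-concat-blocks (blocks D′) (valid D′)))
        (subst₂ (λ j l → j * suc B + (c * B + 1) ≤ l + t₁) k≡ (sym S-length′) lower′)

    absurd : ⊥
    absurd with all? (λ B′ → suc B ≤? length B′) (blocks D)
    ... | yes full = all-full full
    ... | no ¬full
      with B₀ , B₀∈ , B₀-short ← find (Allₚ.¬All⇒Any¬ (λ B′ → suc B ≤? length B′) (blocks D) ¬full)
      with k′ , k≡ , B₀-block , D′ ← extract-block D B₀∈ = short-block k≡ B₀-block D′ (≰⇒> B₀-short)

  absurd : ⊥
  absurd = Remainder.absurd (proj₂ (greedy-decomposition η₂ k S
    (≤-trans lower′ (+-monoʳ-≤ (length S) (≤-trans t₁≤B (n≤1+n B))))))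

near-η-has-short-zero-sum : ∀ {r A B c t₁ t₂} → t₂ ≤ t₁ → t₁ ≤ B → t₂ ≡ 1 ⊎ t₂ ≡ 2 → 1 ≤ B →
  Threshold (suc A) (suc r) HasShortZS (c * A + 1) → IsEta (suc B) (suc r) (c * B + 1) → PropertyC (suc B) (suc r) →
  (∀ (T : Seq (suc B) (suc r)) →
    (c * B + 1) ∸ t₁ ≤ length T → length T ≤ (c * B + 1) ∸ t₂ → ZeroSum T → HasShortZS T) →
  ∀ (S : Seq (suc A * suc B) (suc r)) → ZeroSum S →
  c * (B + A * suc B) + 1 ≤ length S + t₁ → length S ≤ (c * (B + A * suc B) + 1) ∸ t₂ → HasShortZS S
near-η-has-short-zero-sum {c = c} t₂≤t₁ t₁≤B t₂∈ 1≤B η₁ η₂ PC C₀ S zero-sum lower upper with HasShortZS? S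
... | yes has-short = has-short
... | no short-free =
  let 1≤cB , B∣multiplicities = PropertyC⇒multiplicities {c = c} 1≤B η₂ PC in
  ⊥-elim (NearEta.absurd {c = c} t₂≤t₁ t₁≤B t₂∈ η₁ (proj₁ η₂) 1≤cB B∣multiplicities C₀
    S zero-sum lower upper short-free)

davenport-below-window : ∀ {r A B c d₂ d t t₁} →
  IsEta (suc A) (suc r) (c * A + 1) → IsD (suc B) (suc r) d₂ → IsD (suc A * suc B) (suc r) d →
  suc d₂ + t₁ ≤ c * B + 1 → c * (B + A * suc B) + 1 ≤ t + t₁ → suc d ≤ t
davenport-below-window {A = A} {B} {c} {d = d} {t₁ = t₁} η₁ D₂ D d₂-bound lower = +-cancelʳ-≤ t₁ _ _ (≤-trans
  (subst (suc d + t₁ ≤_) (sym (η-split₁ c A B)) (davenport-window (davenport-product-bound η₁ D₂ D) d₂-bound))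
  lower)

lemma2p3 : (r n₁ n₂ c : ℕ) → 2 ≤ n₁ → 2 ≤ n₂ →
    (e₁ e₂ e d₂ d : ℕ) →
    IsEta n₁ r e₁ → IsEta n₂ r e₂ → IsEta (n₁ * n₂) r e →
    IsD n₂ r d₂ → IsD (n₁ * n₂) r d →
    e₁ ≡ c * (n₁ ∸ 1) + 1 → e₂ ≡ c * (n₂ ∸ 1) + 1 → e ≡ c * (n₁ * n₂ ∸ 1) + 1 →
    PropertyC n₂ r →
    (t₁ t₂ : ℕ) → 1 ≤ t₁ → t₁ ≤ n₂ ∸ 1 → (t₂ ≡ 1 ⊎ t₂ ≡ 2) → t₂ ≤ t₁ →
    ((t : ℕ) → e₂ ∸ t₁ ≤ t → t ≤ e₂ ∸ t₂ → InC0 n₂ r d₂ e₂ t) →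
    (t : ℕ) → e ∸ t₁ ≤ t → t ≤ e ∸ t₂ → InC0 (n₁ * n₂) r d e t
lemma2p3 zero _ _ _ _ 2≤n₂ _ _ _ _ _ _ _ _ _ _ _ _ _ PC _ _ _ _ _ _ _ _ _ _ = ⊥-elim (¬PropertyC-rank-zero 2≤n₂ PC)
lemma2p3 (suc r) (suc A) (suc B) c _ (s≤s 1≤B) _ _ _ d₂ _ η₁ η₂ _ D₂ D refl refl refl
         PC t₁ t₂ _ t₁≤B t₂∈ t₂≤t₁ C₀₂ _ lower upper =
  davenport-below-window {c = c} η₁ D₂ D d₂-bound (∸⇒≤+ lower) ,
  <-∸-positive (1-or-2⇒1≤ t₂∈) upper ,
  λ { S zero-sum refl →
    near-η-has-short-zero-sum {c = c} t₂≤t₁ t₁≤B t₂∈ 1≤B (proj₁ η₁) η₂ PC C₀ S zero-sum (∸⇒≤+ lower) upper }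
  where
  C₀ : ∀ (T : Seq (suc B) (suc r)) →
    (c * B + 1) ∸ t₁ ≤ length T → length T ≤ (c * B + 1) ∸ t₂ → ZeroSum T → HasShortZS T
  C₀ T lower upper zero-sum = proj₂ (proj₂ (C₀₂ (length T) lower upper)) T zero-sum refl
  d₂-bound : suc d₂ + t₁ ≤ c * B + 1
  d₂-bound = positive-≤-∸⇒+≤ (s≤s z≤n) (proj₁ (C₀₂ _ ≤-refl (∸-monoʳ-≤ _ t₂≤t₁)))
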